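{- For a connected skew shape $\lambda/\mu$, $\mathrm{ED}(\lambda/\mu)\le\mathrm{OOT}(\lambda/\mu)$.
   Context: $[\lambda]=\{(i,j):1\le i\le\ell(\lambda),1\le j\le\lambda_i\}$ (English convention). Excited diagrams: for $D\subseteq[\lambda]$, a cell $(i,j)\in D$ is active if $(i+1,j),(i,j+1),(i+1,j+1)\in[\lambda]\setminus D$; an excited move replaces it by $(i+1,j+1)$. $\mathcal{E}(\lambda/\mu)$ is the set of subsets of $[\lambda]$ obtained from $[\mu]$ by finite sequences of excited moves, $\mathrm{ED}(\lambda/\mu)=|\mathcal{E}(\lambda/\mu)|$. With $d=\ell(\lambda)$, $\mathrm{OOT}(\lambda/\mu)$ is the number of SSYT $T$ of shape $\mu$ (weakly increasing rows, strictly increasing columns) with entries in $\{1,\dots,d\}$ such that $j-i<\lambda_{d+1-T(i,j)}$ for all $(i,j)\in[\mu]$. Throughout the paper skew shapes are assumed connected. -}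

module Defs where

open import Data.Nat using (ℕ; zero; suc; _+_; _∸_; _≤_; _<_; _≤ᵇ_; _<ᵇ_)
open import Data.Bool using (Bool; true; false; _∧_)
open import Data.Product using (_×_; _,_)
open import Data.Sum using (_⊎_)
open import Data.List using (List; []; _∷_; length; map; concatMap; upTo; filterᵇ)
open import Data.List.Membership.Propositional using (_∈_)
open import Data.List.Relation.Unary.All using (All)
open import Data.List.Relation.Unary.AllPairs using (AllPairs)
open import Relation.Binary.PropositionalEquality using (_≡_)
open import Relation.Nullary using (¬_)

-- Partitions, Young diagrams (English convention, 1-based cells (i , j))

Cell : Set
Cell = ℕ × ℕ

row : List ℕ → ℕ → ℕ
row []           _             = 0
row (x ∷ xs)     zero          = 0
row (x ∷ xs)     (suc zero)    = x
row (x ∷ xs)     (suc (suc i)) = row xs (suc i)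

data IsPartition : List ℕ → Set where
  nil  : IsPartition []
  one  : ∀ {a} → 1 ≤ a → IsPartition (a ∷ [])
  cons : ∀ {a b p} → b ≤ a → IsPartition (b ∷ p) → IsPartition (a ∷ b ∷ p)

InShape : List ℕ → Cell → Set
InShape p (i , j) = 1 ≤ j × j ≤ row p i

_⊆ₚ_ : List ℕ → List ℕ → Set
mu ⊆ₚ la = ∀ i → row mu i ≤ row la i

SkewCell : List ℕ → List ℕ → Cell → Set
SkewCell la mu c = InShape la c × ¬ InShape mu c

Adj : Cell → Cell → Set
Adj (i , j) (i' , j') =
  (i' ≡ suc i × j' ≡ j) ⊎ (i ≡ suc i' × j ≡ j') ⊎
  (i' ≡ i × j' ≡ suc j) ⊎ (i ≡ i' × j ≡ suc j')

data Path (la mu : List ℕ) : Cell → Cell → Set where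
  here  : ∀ {c} → Path la mu c c
  there : ∀ {a b c} → Adj a b → SkewCell la mu b → Path la mu b c → Path la mu a c

Connected : List ℕ → List ℕ → Set
Connected la mu = ∀ a b → SkewCell la mu a → SkewCell la mu b → Path la mu a b

-- Excited diagrams.  A diagram D ⊆ [λ] is represented by a list of cells,
-- read as the finite set of its members; _≐_ is equality as sets.

_≐_ : List Cell → List Cell → Set
A ≐ B = ∀ x → (x ∈ A → x ∈ B) × (x ∈ B → x ∈ A)

Active : List ℕ → List Cell → Cell → Set
Active la D (i , j) =
  (InShape la (suc i , j) × ¬ (suc i , j) ∈ D) ×
  (InShape la (i , suc j) × ¬ (i , suc j) ∈ D) ×
  (InShape la (suc i , suc j) × ¬ (suc i , suc j) ∈ D)

IsMove : List Cell → Cell → List Cell → Set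
IsMove D (i , j) D' =
  ∀ x → (x ∈ D' → (x ∈ D × ¬ x ≡ (i , j)) ⊎ x ≡ (suc i , suc j)) ×
        ((x ∈ D × ¬ x ≡ (i , j)) ⊎ x ≡ (suc i , suc j) → x ∈ D')

data Excited (la mu : List ℕ) : List Cell → Set where
  base : ∀ {D} → (∀ x → (x ∈ D → InShape mu x) × (InShape mu x → x ∈ D)) →
         Excited la mu D
  step : ∀ {D D'} c → Excited la mu D → c ∈ D → Active la D c →
         IsMove D c D' → Excited la mu D'

-- OOT(λ/μ).  A filling of shape μ is a list of rows, row i a list of μ_i
-- entries; we enumerate all fillings with entries in {1,…,d}.

range1 : ℕ → List ℕ
range1 d = map suc (upTo d)

words : ℕ → ℕ → List (List ℕ)
words zero    d = [] ∷ []
words (suc n) d = concatMap (λ t → map (t ∷_) (words n d)) (range1 d)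

fillings : List ℕ → ℕ → List (List (List ℕ))
fillings []       d = [] ∷ []
fillings (m ∷ ms) d = concatMap (λ r → map (r ∷_) (fillings ms d)) (words m d)

weakIncr : List ℕ → Bool
weakIncr (x ∷ y ∷ xs) = (x ≤ᵇ y) ∧ weakIncr (y ∷ xs)
weakIncr _            = true

strictBelow : List ℕ → List ℕ → Bool
strictBelow (x ∷ xs) (y ∷ ys) = (x <ᵇ y) ∧ strictBelow xs ys
strictBelow _        _        = true

rowsOK : List (List ℕ) → Bool
rowsOK []       = true
rowsOK (r ∷ rs) = weakIncr r ∧ rowsOK rs

colsOK : List (List ℕ) → Bool
colsOK (r ∷ r' ∷ rs) = strictBelow r r' ∧ colsOK (r' ∷ rs)
colsOK _             = true

-- condition  j - i < λ_{d+1-T(i,j)}, written  j < λ_{d+1-T(i,j)} + i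
flagRow : List ℕ → ℕ → ℕ → ℕ → List ℕ → Bool
flagRow la d i j []       = true
flagRow la d i j (t ∷ ts) = (j <ᵇ row la (suc d ∸ t) + i) ∧ flagRow la d i (suc j) ts

flagOK : List ℕ → ℕ → ℕ → List (List ℕ) → Bool
flagOK la d i []       = true
flagOK la d i (r ∷ rs) = flagRow la d i 1 r ∧ flagOK la d (suc i) rs

isOOT : List ℕ → List (List ℕ) → Bool
isOOT la T = rowsOK T ∧ colsOK T ∧ flagOK la (length la) 1 T

OOT : List ℕ → List ℕ → ℕ
OOT la mu = length (filterᵇ (isOOT la) (fillings mu (length la)))

-- An excited diagram is determined by how far each cell (i , j) of μ has slid
-- down its diagonal, k(i , j). A cell can only be moved once its lower and
-- right neighbours have moved strictly further, so k stays weakly increasing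
-- along rows and columns. Filling (i , j) with T(i , j) = d − λ′_{j+k} + i + k
-- turns this monotonicity into the tableau conditions, and the containment
-- (i + k , j + k) ∈ [λ] into 1 ≤ T ≤ d and the flag condition; T is strictly
-- increasing in k, so distinct excited diagrams give distinct tableaux.

module Submission where

open import Defs
open import Data.Nat using (ℕ; _≤_)
open import Data.List using (List; length)
open import Data.List.Relation.Unary.All using (All)
open import Data.List.Relation.Unary.AllPairs using (AllPairs)
open import Relation.Nullary using (¬_)

open import Data.Nat
open import Data.Nat.Properties
open import Data.Bool using (_∧_; T)
open import Data.Bool.Properties using (T-∧; T?)
open import Data.Product using (∃; ∃-syntax; _×_; _,_; proj₁; proj₂)
open import Data.Product.Properties using (≡-dec)
open import Data.Sum using (inj₁; inj₂)
open import Data.Empty using (⊥-elim)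
open import Data.List using ([]; _∷_; map; concatMap; filterᵇ)
open import Data.List.Properties using (∷-injective; length-removeAt′)
open import Data.List.Membership.Propositional using (_∈_; _─_)
open import Data.List.Membership.Propositional.Properties
  using (∈-map⁺; ∈-concatMap⁺; ∈-upTo⁺; ∈-filter⁺)
open import Data.List.Relation.Unary.Any using (here; there; index)
import Data.List.Relation.Unary.Any as Any
import Data.List.Relation.Unary.All as All
open import Data.List.Relation.Unary.All using ([]; _∷_)
open import Data.List.Relation.Unary.AllPairs using ([]; _∷_)
open import Function using (Equivalence; _∘_)
open import Relation.Binary.Definitions using (tri<; tri≈; tri>)
open import Relation.Binary.PropositionalEquality
open import Relation.Nullary using (Dec; yes; no)

∈-─⁺ : ∀ {A : Set} {x y : A} {xs : List A} (x∈xs : x ∈ xs) → y ∈ xs → y ≢ x → y ∈ xs ─ x∈xs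
∈-─⁺ (here refl) (here refl) y≢x = ⊥-elim (y≢x refl)
∈-─⁺ (here refl) (there y∈xs) _ = y∈xs
∈-─⁺ (there x∈xs) (here refl) _ = here refl
∈-─⁺ (there x∈xs) (there y∈xs) y≢x = there (∈-─⁺ x∈xs y∈xs y≢x)

length-≤-by-injectiveRel : ∀ {A B : Set} (_≈_ : A → A → Set) (R : A → B → Set) →
  (∀ {a a′ b} → R a b → R a′ b → a ≈ a′) →
  ∀ {xs ys} → AllPairs (λ a a′ → ¬ a ≈ a′) xs →
  All (λ a → ∃[ b ] b ∈ ys × R a b) xs → length xs ≤ length ys
length-≤-by-injectiveRel _≈_ R inj {[]} _ _ = z≤n
length-≤-by-injectiveRel _≈_ R inj {x ∷ xs} {ys} (x≉xs ∷ distinct) ((b , b∈ys , xRb) ∷ images) =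
  subst (suc (length xs) ≤_) (sym (length-removeAt′ ys (index b∈ys)))
    (s≤s (length-≤-by-injectiveRel _≈_ R inj distinct (avoid x≉xs images)))
  where
  avoid : ∀ {zs} → All (λ z → ¬ x ≈ z) zs → All (λ a → ∃[ c ] c ∈ ys × R a c) zs →
          All (λ a → ∃[ c ] c ∈ ys ─ b∈ys × R a c) zs
  avoid [] [] = []
  avoid (x≉z ∷ x≉zs) ((c , c∈ys , zRc) ∷ imgs) =
    (c , ∈-─⁺ b∈ys c∈ys (λ { refl → x≉z (inj xRb zRc) }) , zRc) ∷ avoid x≉zs imgs

IsPartition-tail : ∀ {x xs} → IsPartition (x ∷ xs) → IsPartition xs
IsPartition-tail (one _) = nil
IsPartition-tail (cons _ p) = p

row≤head : ∀ {x xs} → IsPartition (x ∷ xs) → ∀ r → row xs r ≤ x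
row-antitone : ∀ {p} → IsPartition p → ∀ {i i′} → 1 ≤ i → i ≤ i′ → row p i′ ≤ row p i

row≤head (one _) r = z≤n
row≤head (cons _ _) zero = z≤n
row≤head (cons y≤x p) (suc r) = ≤-trans (row-antitone p {1} {suc r} (s≤s z≤n) (s≤s z≤n)) y≤x

row-antitone nil _ _ = z≤n
row-antitone {_ ∷ _} p {1} {1} _ _ = ≤-refl
row-antitone {_ ∷ _} p {1} {suc (suc i′)} _ _ = row≤head p (suc i′)
row-antitone {_ ∷ _} p {suc (suc i)} {1} _ (s≤s ())
row-antitone {_ ∷ _} p {suc (suc i)} {suc (suc i′)} _ i≤i′ =
  row-antitone (IsPartition-tail p) (s≤s z≤n) (s≤s⁻¹ i≤i′)

InShape⇒1≤i : ∀ p {i j} → InShape p (i , j) → 1 ≤ i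
InShape⇒1≤i [] {zero} (1≤j , j≤0) with () ← ≤-trans 1≤j j≤0
InShape⇒1≤i (_ ∷ _) {zero} (1≤j , j≤0) with () ← ≤-trans 1≤j j≤0
InShape⇒1≤i p {suc i} _ = s≤s z≤n

InShape-downClosed : ∀ {p} → IsPartition p → ∀ {i j i′ j′} → InShape p (i′ , j′) →
  1 ≤ i → i ≤ i′ → 1 ≤ j → j ≤ j′ → InShape p (i , j)
InShape-downClosed p (_ , j′≤row) 1≤i i≤i′ 1≤j j≤j′ =
  1≤j , ≤-trans j≤j′ (≤-trans j′≤row (row-antitone p 1≤i i≤i′))

conjugate : List ℕ → ℕ → ℕ
conjugate [] c = 0
conjugate (x ∷ xs) c with c ≤? x
... | yes _ = suc (conjugate xs c)
... | no _ = 0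

conjugate-antitone : ∀ p {c c′} → c ≤ c′ → conjugate p c′ ≤ conjugate p c
conjugate-antitone [] _ = z≤n
conjugate-antitone (x ∷ xs) {c} {c′} c≤c′ with c′ ≤? x | c ≤? x
... | yes _ | yes _ = s≤s (conjugate-antitone xs c≤c′)
... | yes c′≤x | no c≰x = ⊥-elim (c≰x (≤-trans c≤c′ c′≤x))
... | no _ | _ = z≤n

conjugate≤length : ∀ p c → conjugate p c ≤ length p
conjugate≤length [] c = z≤n
conjugate≤length (x ∷ xs) c with c ≤? x
... | yes _ = s≤s (conjugate≤length xs c)
... | no _ = z≤n

≤conjugate⇒≤row : ∀ p {c r} → 1 ≤ r → r ≤ conjugate p c → c ≤ row p r
≤conjugate⇒≤row [] 1≤r r≤0 with () ← ≤-trans 1≤r r≤0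
≤conjugate⇒≤row (x ∷ xs) {c} {1} _ r≤conj with c ≤? x
... | yes c≤x = c≤x
≤conjugate⇒≤row (x ∷ xs) {c} {suc (suc r)} _ r≤conj with c ≤? x
... | yes _ = ≤conjugate⇒≤row xs (s≤s z≤n) (s≤s⁻¹ r≤conj)

≤row⇒≤conjugate : ∀ {p} → IsPartition p → ∀ {c r} → 1 ≤ c → 1 ≤ r → c ≤ row p r → r ≤ conjugate p c
≤row⇒≤conjugate nil {r = 1} 1≤c _ c≤0 with () ← ≤-trans 1≤c c≤0
≤row⇒≤conjugate nil {r = suc (suc _)} 1≤c _ c≤0 with () ← ≤-trans 1≤c c≤0
≤row⇒≤conjugate {x ∷ xs} p {c} {1} _ _ c≤x with c ≤? x
... | yes _ = s≤s z≤n
... | no c≰x = ⊥-elim (c≰x c≤x)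
≤row⇒≤conjugate {x ∷ xs} p {c} {suc (suc r)} 1≤c _ c≤row with c ≤? x
... | yes _ = s≤s (≤row⇒≤conjugate (IsPartition-tail p) 1≤c (s≤s z≤n) c≤row)
... | no c≰x = ⊥-elim (c≰x (≤-trans c≤row (row≤head p (suc r))))

Shift : Set
Shift = ℕ → ℕ → ℕ

shiftCell : Shift → ℕ → ℕ → Cell
shiftCell k i j = (k i j + i , k i j + j)

record ShiftedCopy (la mu : List ℕ) (D : List Cell) (k : Shift) : Set where
  field
    D⊆image : ∀ x → x ∈ D → ∃[ i ] ∃[ j ] InShape mu (i , j) × x ≡ shiftCell k i j
    image⊆D : ∀ i j → InShape mu (i , j) → shiftCell k i j ∈ D
    image⊆la : ∀ i j → InShape mu (i , j) → InShape la (shiftCell k i j)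
    shift-monotone : ∀ {i j i′ j′} → InShape mu (i , j) → InShape mu (i′ , j′) →
                     i ≤ i′ → j ≤ j′ → k i j ≤ k i′ j′
open ShiftedCopy

module _ {la mu D k} (copy : ShiftedCopy la mu D k) where

  private
    shiftCell-injective-≤ : ∀ {i j i′ j′} → InShape mu (i , j) → InShape mu (i′ , j′) → i ≤ i′ →
      shiftCell k i j ≡ shiftCell k i′ j′ → i ≡ i′ × j ≡ j′
    shiftCell-injective-≤ {i} {j} {i′} {j′} s s′ i≤i′ eq = i≡i′ , j≡j′
      where
      k′≤k : k i′ j′ ≤ k i j
      k′≤k = +-cancelʳ-≤ i (k i′ j′) (k i j)
               (≤-trans (+-monoʳ-≤ (k i′ j′) i≤i′) (≤-reflexive (sym (cong proj₁ eq))))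
      j≤j′ : j ≤ j′
      j≤j′ = +-cancelˡ-≤ (k i′ j′) j j′ (≤-trans (+-monoˡ-≤ j k′≤k) (≤-reflexive (cong proj₂ eq)))
      k≡k′ : k i j ≡ k i′ j′
      k≡k′ = ≤-antisym (shift-monotone copy s s′ i≤i′ j≤j′) k′≤k
      i≡i′ = +-cancelˡ-≡ (k i j) i i′ (trans (cong proj₁ eq) (cong (_+ i′) (sym k≡k′)))
      j≡j′ = +-cancelˡ-≡ (k i j) j j′ (trans (cong proj₂ eq) (cong (_+ j′) (sym k≡k′)))

  shiftCell-injective : ∀ {i j i′ j′} → InShape mu (i , j) → InShape mu (i′ , j′) →
    shiftCell k i j ≡ shiftCell k i′ j′ → (i , j) ≡ (i′ , j′)
  shiftCell-injective {i} {j} {i′} {j′} s s′ eq with ≤-total i i′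
  ... | inj₁ i≤i′ with refl , refl ← shiftCell-injective-≤ s s′ i≤i′ eq = refl
  ... | inj₂ i′≤i with refl , refl ← shiftCell-injective-≤ s′ s i′≤i (sym eq) = refl

_≟ᶜ_ : (x y : Cell) → Dec (x ≡ y)
_≟ᶜ_ = ≡-dec _≟_ _≟_

opaque
  incrementAt : Cell → Shift → Shift
  incrementAt c k i j with (i , j) ≟ᶜ c
  ... | yes _ = suc (k i j)
  ... | no _ = k i j

  incrementAt-here : ∀ k i j → incrementAt (i , j) k i j ≡ suc (k i j)
  incrementAt-here k i j with (i , j) ≟ᶜ (i , j)
  ... | yes _ = refl
  ... | no c≢c = ⊥-elim (c≢c refl)

  incrementAt-elsewhere : ∀ {c} k i j → (i , j) ≢ c → incrementAt c k i j ≡ k i j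
  incrementAt-elsewhere {c} k i j ≢c with (i , j) ≟ᶜ c
  ... | yes ≡c = ⊥-elim (≢c ≡c)
  ... | no _ = refl

shiftCell-incrementAt-here : ∀ k i j →
  shiftCell (incrementAt (i , j) k) i j ≡ (suc (k i j + i) , suc (k i j + j))
shiftCell-incrementAt-here k i j rewrite incrementAt-here k i j = refl

shiftCell-incrementAt-elsewhere : ∀ {c} k i j → (i , j) ≢ c →
  shiftCell (incrementAt c k) i j ≡ shiftCell k i j
shiftCell-incrementAt-elsewhere k i j ≢c rewrite incrementAt-elsewhere k i j ≢c = refl

shiftedCopy-base : ∀ {la mu D} → mu ⊆ₚ la → (∀ x → (x ∈ D → InShape mu x) × (InShape mu x → x ∈ D)) →
  ShiftedCopy la mu D (λ _ _ → 0)
shiftedCopy-base mu⊆la D≐mu = record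
  { D⊆image = λ { (i , j) x∈D → i , j , proj₁ (D≐mu (i , j)) x∈D , refl }
  ; image⊆D = λ i j s → proj₂ (D≐mu (i , j)) s
  ; image⊆la = λ i j (1≤j , j≤mu) → 1≤j , ≤-trans j≤mu (mu⊆la i)
  ; shift-monotone = λ _ _ _ _ → z≤n }

module ExcitedMove {la mu : List ℕ} (mu-partition : IsPartition mu) {D D′ : List Cell} {k : Shift}
  (copy : ShiftedCopy la mu D k) {i₀ j₀ : ℕ} (s₀ : InShape mu (i₀ , j₀))
  (active : Active la D (shiftCell k i₀ j₀)) (move : IsMove D (shiftCell k i₀ j₀) D′) where

  k₀ : ℕ
  k₀ = k i₀ j₀

  -- The cells just below and just right of the moved cell are empty, so the
  -- neighbours of (i₀ , j₀) in μ have been moved strictly further.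
  k₀<below : ∀ {i j} → InShape mu (i , j) → i₀ < i → j₀ ≤ j → k₀ < k i j
  k₀<below {i} {j} s i₀<i j₀≤j = <-≤-trans (≤∧≢⇒< k₀≤k₁ k₀≢k₁) (shift-monotone copy s₁ s i₀<i j₀≤j)
    where
    s₁ = InShape-downClosed mu-partition s (s≤s z≤n) i₀<i (proj₁ s₀) j₀≤j
    k₀≤k₁ = shift-monotone copy s₀ s₁ (n≤1+n i₀) ≤-refl
    k₀≢k₁ : k₀ ≢ k (suc i₀) j₀
    k₀≢k₁ eq = proj₂ (proj₁ active) (subst (_∈ D)
      (cong₂ _,_ (trans (cong (_+ suc i₀) (sym eq)) (+-suc k₀ i₀)) (cong (_+ j₀) (sym eq)))
      (image⊆D copy (suc i₀) j₀ s₁))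

  k₀<right : ∀ {i j} → InShape mu (i , j) → i₀ ≤ i → j₀ < j → k₀ < k i j
  k₀<right {i} {j} s i₀≤i j₀<j = <-≤-trans (≤∧≢⇒< k₀≤k₁ k₀≢k₁) (shift-monotone copy s₁ s i₀≤i j₀<j)
    where
    s₁ = InShape-downClosed mu-partition s (InShape⇒1≤i mu s₀) i₀≤i (s≤s z≤n) j₀<j
    k₀≤k₁ = shift-monotone copy s₀ s₁ ≤-refl (n≤1+n j₀)
    k₀≢k₁ : k₀ ≢ k i₀ (suc j₀)
    k₀≢k₁ eq = proj₂ (proj₁ (proj₂ active)) (subst (_∈ D)
      (cong₂ _,_ (cong (_+ i₀) (sym eq)) (trans (cong (_+ suc j₀) (sym eq)) (+-suc k₀ j₀)))
      (image⊆D copy i₀ (suc j₀) s₁))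

  k₀<beyond : ∀ {i j} → InShape mu (i , j) → i₀ ≤ i → j₀ ≤ j → (i , j) ≢ (i₀ , j₀) → k₀ < k i j
  k₀<beyond s i₀≤i j₀≤j ≢₀ with m≤n⇒m<n∨m≡n i₀≤i | m≤n⇒m<n∨m≡n j₀≤j
  ... | inj₁ i₀<i | _ = k₀<below s i₀<i j₀≤j
  ... | inj₂ refl | inj₁ j₀<j = k₀<right s i₀≤i j₀<j
  ... | inj₂ refl | inj₂ refl = ⊥-elim (≢₀ refl)

  k′ : Shift
  k′ = incrementAt (i₀ , j₀) k

  k′-monotone : ∀ {i j i′ j′} → InShape mu (i , j) → InShape mu (i′ , j′) →
                i ≤ i′ → j ≤ j′ → k′ i j ≤ k′ i′ j′
  k′-monotone {i} {j} {i′} {j′} s s′ i≤i′ j≤j′ with (i , j) ≟ᶜ (i₀ , j₀) | (i′ , j′) ≟ᶜ (i₀ , j₀)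
  ... | yes refl | yes refl = ≤-refl
  ... | yes refl | no ≢₀′
    rewrite incrementAt-here k i j | incrementAt-elsewhere k i′ j′ ≢₀′ = k₀<beyond s′ i≤i′ j≤j′ ≢₀′
  ... | no ≢₀ | yes refl
    rewrite incrementAt-elsewhere k i j ≢₀ | incrementAt-here k i′ j′ =
      m≤n⇒m≤1+n (shift-monotone copy s s′ i≤i′ j≤j′)
  ... | no ≢₀ | no ≢₀′
    rewrite incrementAt-elsewhere k i j ≢₀ | incrementAt-elsewhere k i′ j′ ≢₀′ =
      shift-monotone copy s s′ i≤i′ j≤j′

  shiftedCopy : ShiftedCopy la mu D′ k′
  D⊆image shiftedCopy x x∈D′ with proj₁ (move x) x∈D′
  ... | inj₂ refl = i₀ , j₀ , s₀ , sym (shiftCell-incrementAt-here k i₀ j₀)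
  ... | inj₁ (x∈D , x≢₀) with D⊆image copy x x∈D
  ...   | i , j , s , refl with (i , j) ≟ᶜ (i₀ , j₀)
  ...     | yes refl = ⊥-elim (x≢₀ refl)
  ...     | no ≢₀ = i , j , s , sym (shiftCell-incrementAt-elsewhere k i j ≢₀)
  image⊆D shiftedCopy i j s with (i , j) ≟ᶜ (i₀ , j₀)
  ... | yes refl = subst (_∈ D′) (sym (shiftCell-incrementAt-here k i₀ j₀)) (proj₂ (move _) (inj₂ refl))
  ... | no ≢₀ = subst (_∈ D′) (sym (shiftCell-incrementAt-elsewhere k i j ≢₀))
                  (proj₂ (move _) (inj₁ (image⊆D copy i j s , λ eq → ≢₀ (shiftCell-injective copy s s₀ eq))))
  image⊆la shiftedCopy i j s with (i , j) ≟ᶜ (i₀ , j₀)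
  ... | yes refl =
    subst (InShape la) (sym (shiftCell-incrementAt-here k i₀ j₀)) (proj₁ (proj₂ (proj₂ active)))
  ... | no ≢₀ = subst (InShape la) (sym (shiftCell-incrementAt-elsewhere k i j ≢₀)) (image⊆la copy i j s)
  shift-monotone shiftedCopy = k′-monotone

excited⇒shiftedCopy : ∀ {la mu D} → IsPartition mu → mu ⊆ₚ la → Excited la mu D → ∃ (ShiftedCopy la mu D)
excited⇒shiftedCopy mu-partition mu⊆la (base D≐mu) = _ , shiftedCopy-base mu⊆la D≐mu
excited⇒shiftedCopy mu-partition mu⊆la (step c E c∈D active move)
  with k , copy ← excited⇒shiftedCopy mu-partition mu⊆la E
  with i₀ , j₀ , s₀ , refl ← D⊆image copy c c∈D
  = _ , ExcitedMove.shiftedCopy mu-partition copy s₀ active move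

T-∧-intro : ∀ {a b} → T a → T b → T (a ∧ b)
T-∧-intro ta tb = Equivalence.from T-∧ (ta , tb)

OnRange : (ℕ → Set) → ℕ → ℕ → Set
OnRange P j₀ m = ∀ j → j₀ ≤ j → j < j₀ + m → P j

OnRange-head : ∀ {P j₀ m} → OnRange P j₀ (suc m) → P j₀
OnRange-head {j₀ = j₀} H = H j₀ ≤-refl (m<m+n j₀ z<s)

OnRange-tail : ∀ {P j₀ m} → OnRange P j₀ (suc m) → OnRange P (suc j₀) m
OnRange-tail {j₀ = j₀} {m} H j j₀<j j<1+j₀+m = H j (<⇒≤ j₀<j) (subst (j <_) (sym (+-suc j₀ m)) j<1+j₀+m)

tabulateRow : (ℕ → ℕ) → ℕ → ℕ → List ℕ
tabulateRow f j₀ zero = []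
tabulateRow f j₀ (suc m) = f j₀ ∷ tabulateRow f (suc j₀) m

tabulateFilling : List ℕ → (ℕ → ℕ → ℕ) → List (List ℕ)
tabulateFilling [] V = []
tabulateFilling (m ∷ ms) V = tabulateRow (V 1) 1 m ∷ tabulateFilling ms (λ r → V (suc r))

∈-range1 : ∀ {t d} → 1 ≤ t → t ≤ d → t ∈ range1 d
∈-range1 {suc t} _ t<d = ∈-map⁺ suc (∈-upTo⁺ t<d)

tabulateRow∈words : ∀ d f j₀ m → OnRange (λ j → 1 ≤ f j × f j ≤ d) j₀ m → tabulateRow f j₀ m ∈ words m d
tabulateRow∈words d f j₀ zero H = here refl
tabulateRow∈words d f j₀ (suc m) H =
  ∈-concatMap⁺ (λ t → map (t ∷_) (words m d))
    (Any.map (λ { refl → ∈-map⁺ (f j₀ ∷_) (tabulateRow∈words d f (suc j₀) m (OnRange-tail H)) })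
      (∈-range1 (proj₁ (OnRange-head H)) (proj₂ (OnRange-head H))))

weakIncr-tabulateRow : ∀ f j₀ m → OnRange (λ j → f j ≤ f (suc j)) j₀ (pred m) →
  T (weakIncr (tabulateRow f j₀ m))
weakIncr-tabulateRow f j₀ zero H = _
weakIncr-tabulateRow f j₀ (suc zero) H = _
weakIncr-tabulateRow f j₀ (suc (suc m)) H =
  T-∧-intro (≤⇒≤ᵇ (OnRange-head H)) (weakIncr-tabulateRow f (suc j₀) (suc m) (OnRange-tail H))

strictBelow-tabulateRow : ∀ f g j₀ m m′ → m′ ≤ m → OnRange (λ j → f j < g j) j₀ m′ →
  T (strictBelow (tabulateRow f j₀ m) (tabulateRow g j₀ m′))
strictBelow-tabulateRow f g j₀ zero zero _ H = _
strictBelow-tabulateRow f g j₀ (suc m) zero _ H = _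
strictBelow-tabulateRow f g j₀ (suc m) (suc m′) m′≤m H =
  T-∧-intro (<⇒<ᵇ (OnRange-head H))
            (strictBelow-tabulateRow f g (suc j₀) m m′ (s≤s⁻¹ m′≤m) (OnRange-tail H))

flagRow-tabulateRow : ∀ la d i f j₀ m → 1 ≤ i → OnRange (λ j → j ≤ row la (suc d ∸ f j)) j₀ m →
  T (flagRow la d i j₀ (tabulateRow f j₀ m))
flagRow-tabulateRow la d i f j₀ zero _ H = _
flagRow-tabulateRow la d i f j₀ (suc m) 1≤i H =
  T-∧-intro (<⇒<ᵇ (≤-<-trans (OnRange-head H) (m<m+n _ 1≤i)))
            (flagRow-tabulateRow la d i f (suc j₀) m 1≤i (OnRange-tail H))

tabulateRow-injective : ∀ f g j₀ m → tabulateRow f j₀ m ≡ tabulateRow g j₀ m → OnRange (λ j → f j ≡ g j) j₀ m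
tabulateRow-injective f g j₀ zero _ j j₀≤j j<j₀+0 =
  ⊥-elim (<⇒≱ (subst (j <_) (+-identityʳ j₀) j<j₀+0) j₀≤j)
tabulateRow-injective f g j₀ (suc m) eq j j₀≤j j<j₀+m with m≤n⇒m<n∨m≡n j₀≤j
... | inj₂ refl = proj₁ (∷-injective eq)
... | inj₁ j₀<j = tabulateRow-injective f g (suc j₀) m (proj₂ (∷-injective eq)) j j₀<j
                    (subst (j <_) (+-suc j₀ m) j<j₀+m)

InShape-∷ : ∀ {m ms r j} → InShape ms (r , j) → InShape (m ∷ ms) (suc r , j)
InShape-∷ {ms = []} {zero} (1≤j , j≤0) with () ← ≤-trans 1≤j j≤0
InShape-∷ {ms = _ ∷ _} {zero} (1≤j , j≤0) with () ← ≤-trans 1≤j j≤0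
InShape-∷ {r = suc r} s = s

OnShape : List ℕ → (ℕ → ℕ → Set) → Set
OnShape ms P = ∀ r j → InShape ms (r , j) → P r j

OnShape-head : ∀ {m ms P} → OnShape (m ∷ ms) P → OnRange (P 1) 1 m
OnShape-head H j 1≤j j<1+m = H 1 j (1≤j , s≤s⁻¹ j<1+m)

OnShape-tail : ∀ {m ms P} → OnShape (m ∷ ms) P → OnShape ms (λ r → P (suc r))
OnShape-tail {m} {ms} H r j s = H (suc r) j (InShape-∷ {m} {ms} {r} s)

tabulateFilling∈fillings : ∀ ms V d → OnShape ms (λ r j → 1 ≤ V r j × V r j ≤ d) →
  tabulateFilling ms V ∈ fillings ms d
tabulateFilling∈fillings [] V d H = here refl
tabulateFilling∈fillings (m ∷ ms) V d H =
  ∈-concatMap⁺ (λ r → map (r ∷_) (fillings ms d))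
    (Any.map (λ { refl → ∈-map⁺ (tabulateRow (V 1) 1 m ∷_)
                           (tabulateFilling∈fillings ms (λ r → V (suc r)) d (OnShape-tail H)) })
      (tabulateRow∈words d (V 1) 1 m (OnShape-head H)))

rowsOK-tabulateFilling : ∀ ms V → (∀ r j → 1 ≤ j → InShape ms (r , suc j) → V r j ≤ V r (suc j)) →
  T (rowsOK (tabulateFilling ms V))
rowsOK-tabulateFilling [] V H = _
rowsOK-tabulateFilling (m ∷ ms) V H =
  T-∧-intro (weakIncr-tabulateRow (V 1) 1 m (λ j 1≤j j<m → H 1 j 1≤j (s≤s z≤n , pred-bound m 1≤j j<m)))
            (rowsOK-tabulateFilling ms (λ r → V (suc r))
              (λ r j 1≤j s → H (suc r) j 1≤j (InShape-∷ {m} {ms} {r} s)))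
  where
  pred-bound : ∀ m {j} → 1 ≤ j → j < 1 + pred m → j < m
  pred-bound zero 1≤j j<1 with s≤s () ← ≤-trans (s≤s 1≤j) j<1
  pred-bound (suc m) _ j<m = j<m

colsOK-tabulateFilling : ∀ ms V → IsPartition ms →
  (∀ r j → 1 ≤ r → InShape ms (suc r , j) → V r j < V (suc r) j) →
  T (colsOK (tabulateFilling ms V))
colsOK-tabulateFilling [] V _ H = _
colsOK-tabulateFilling (m ∷ []) V _ H = _
colsOK-tabulateFilling (m ∷ m′ ∷ ms) V (cons m′≤m p) H =
  T-∧-intro (strictBelow-tabulateRow (V 1) (V 2) 1 m m′ m′≤m
              (λ j 1≤j j<1+m′ → H 1 j ≤-refl (1≤j , s≤s⁻¹ j<1+m′)))
            (colsOK-tabulateFilling (m′ ∷ ms) (λ r → V (suc r)) p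
              (λ r j _ s → H (suc r) j (s≤s z≤n) (InShape-∷ {m} {m′ ∷ ms} {suc r} s)))

flagOK-tabulateFilling : ∀ la d ms V i → 1 ≤ i → OnShape ms (λ r j → j ≤ row la (suc d ∸ V r j)) →
  T (flagOK la d i (tabulateFilling ms V))
flagOK-tabulateFilling la d [] V i _ H = _
flagOK-tabulateFilling la d (m ∷ ms) V i 1≤i H =
  T-∧-intro (flagRow-tabulateRow la d i (V 1) 1 m 1≤i (OnShape-head H))
            (flagOK-tabulateFilling la d ms (λ r → V (suc r)) (suc i) (s≤s z≤n) (OnShape-tail H))

tabulateFilling-injective : ∀ ms V W → tabulateFilling ms V ≡ tabulateFilling ms W →
  OnShape ms (λ r j → V r j ≡ W r j)
tabulateFilling-injective [] V W _ r j (1≤j , j≤0) with () ← ≤-trans 1≤j j≤0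
tabulateFilling-injective (m ∷ ms) V W _ zero j (1≤j , j≤0) with () ← ≤-trans 1≤j j≤0
tabulateFilling-injective (m ∷ ms) V W eq (suc zero) j (1≤j , j≤m) =
  tabulateRow-injective (V 1) (W 1) 1 m (proj₁ (∷-injective eq)) j 1≤j (s≤s j≤m)
tabulateFilling-injective (m ∷ ms) V W eq (suc (suc r)) j s =
  tabulateFilling-injective ms (λ r → V (suc r)) (λ r → W (suc r)) (proj₂ (∷-injective eq)) (suc r) j s

∸-bound : ∀ {d l x} → l ≤ d → 1 ≤ x → suc d ∸ (d ∸ l + x) ≤ l
∸-bound {d} {l} {x} l≤d 1≤x = m≤n+o⇒m∸n≤o (suc d) (d ∸ l + x) (begin
  suc d               ≡⟨ +-comm 1 d ⟩
  d + 1               ≤⟨ +-monoʳ-≤ d 1≤x ⟩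
  d + x               ≡⟨ cong (_+ x) (sym (m∸n+n≡m l≤d)) ⟩
  d ∸ l + l + x       ≡⟨ +-assoc (d ∸ l) l x ⟩
  d ∸ l + (l + x)     ≡⟨ cong (d ∸ l +_) (+-comm l x) ⟩
  d ∸ l + (x + l)     ≡⟨ sym (+-assoc (d ∸ l) x l) ⟩
  d ∸ l + x + l       ∎)
  where open ≤-Reasoning

module Encoding {la mu : List ℕ} (la-partition : IsPartition la) (mu-partition : IsPartition mu)
  (mu⊆la : mu ⊆ₚ la) where

  d : ℕ
  d = length la

  entry : ℕ → ℕ → ℕ → ℕ
  entry K r j = d ∸ conjugate la (K + j) + (K + r)

  filling : Shift → List (List ℕ)
  filling k = tabulateFilling mu (λ r j → entry (k r j) r j)

  entry-mono-≤ : ∀ {K K′ r r′ j j′} → K ≤ K′ → r ≤ r′ → j ≤ j′ → entry K r j ≤ entry K′ r′ j′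
  entry-mono-≤ K≤K′ r≤r′ j≤j′ =
    +-mono-≤ (∸-monoʳ-≤ d (conjugate-antitone la (+-mono-≤ K≤K′ j≤j′))) (+-mono-≤ K≤K′ r≤r′)

  entry-mono-< : ∀ {K K′ r r′ j j′} → K ≤ K′ → K + r < K′ + r′ → j ≤ j′ → entry K r j < entry K′ r′ j′
  entry-mono-< K≤K′ K+r<K′+r′ j≤j′ =
    +-mono-≤-< (∸-monoʳ-≤ d (conjugate-antitone la (+-mono-≤ K≤K′ j≤j′))) K+r<K′+r′

  entry-monoˡ-< : ∀ {K K′} r j → K < K′ → entry K r j < entry K′ r j
  entry-monoˡ-< r j K<K′ = entry-mono-< (<⇒≤ K<K′) (+-monoˡ-< r K<K′) ≤-refl

  entry-injectiveˡ : ∀ {K K′} r j → entry K r j ≡ entry K′ r j → K ≡ K′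
  entry-injectiveˡ {K} {K′} r j eq with <-cmp K K′
  ... | tri< K<K′ _ _ = ⊥-elim (<-irrefl eq (entry-monoˡ-< r j K<K′))
  ... | tri≈ _ K≡K′ _ = K≡K′
  ... | tri> _ _ K′<K = ⊥-elim (<-irrefl (sym eq) (entry-monoˡ-< r j K′<K))

  -- (K + r , K + j) ∈ [λ] says exactly K + r ≤ λ′_{K+j}, which bounds the entry T
  -- by d and makes row d + 1 − T of λ at least K + j long.
  module _ {D k} (copy : ShiftedCopy la mu D k) {r j} (s : InShape mu (r , j)) where
    private
      K = k r j
      L = conjugate la (K + j)
      1≤K+r : 1 ≤ K + r
      1≤K+r = ≤-trans (InShape⇒1≤i mu s) (m≤n+m r K)
      K+r≤L : K + r ≤ L
      K+r≤L = ≤row⇒≤conjugate la-partition (proj₁ (image⊆la copy r j s)) 1≤K+r (proj₂ (image⊆la copy r j s))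
      L≤d : L ≤ d
      L≤d = conjugate≤length la (K + j)

    1≤entry : 1 ≤ entry K r j
    1≤entry = ≤-trans 1≤K+r (m≤n+m (K + r) (d ∸ L))

    entry≤d : entry K r j ≤ d
    entry≤d = ≤-trans (+-monoʳ-≤ (d ∸ L) K+r≤L) (≤-reflexive (m∸n+n≡m L≤d))

    entry-flagged : j ≤ row la (suc d ∸ entry K r j)
    entry-flagged = ≤-trans (m≤n+m j K)
      (≤conjugate⇒≤row la (m<n⇒0<n∸m (s≤s entry≤d)) (∸-bound L≤d 1≤K+r))

  entry-weakIncrʳ : ∀ {D k} → ShiftedCopy la mu D k → ∀ r j → 1 ≤ j → InShape mu (r , suc j) →
    entry (k r j) r j ≤ entry (k r (suc j)) r (suc j)
  entry-weakIncrʳ copy r j 1≤j s′ = entry-mono-≤ k≤k′ ≤-refl (n≤1+n j)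
    where
    s = 1≤j , ≤-trans (n≤1+n j) (proj₂ s′)
    k≤k′ = shift-monotone copy s s′ ≤-refl (n≤1+n j)

  entry-strictIncrᵈ : ∀ {D k} → ShiftedCopy la mu D k → ∀ r j → 1 ≤ r → InShape mu (suc r , j) →
    entry (k r j) r j < entry (k (suc r) j) (suc r) j
  entry-strictIncrᵈ copy r j 1≤r s′ = entry-mono-< k≤k′ (+-mono-≤-< k≤k′ (n<1+n r)) ≤-refl
    where
    s = InShape-downClosed mu-partition s′ 1≤r (n≤1+n r) (proj₁ s′) ≤-refl
    k≤k′ = shift-monotone copy s s′ (n≤1+n r) ≤-refl

  isOOT-filling : ∀ {D k} → ShiftedCopy la mu D k → T (isOOT la (filling k))
  isOOT-filling {k = k} copy =
    T-∧-intro (rowsOK-tabulateFilling mu V (entry-weakIncrʳ copy))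
      (T-∧-intro (colsOK-tabulateFilling mu V mu-partition (entry-strictIncrᵈ copy))
        (flagOK-tabulateFilling la d mu V 1 ≤-refl (λ r j s → entry-flagged copy s)))
    where
    V = λ r j → entry (k r j) r j

  OOTs : List (List (List ℕ))
  OOTs = filterᵇ (isOOT la) (fillings mu d)

  filling∈OOTs : ∀ {D k} → ShiftedCopy la mu D k → filling k ∈ OOTs
  filling∈OOTs {k = k} copy = ∈-filter⁺ (T? ∘ isOOT la)
    (tabulateFilling∈fillings mu _ d (λ r j s → 1≤entry copy s , entry≤d copy s)) (isOOT-filling copy)

  Encodes : List Cell → List (List ℕ) → Set
  Encodes D F = ∃[ k ] ShiftedCopy la mu D k × F ≡ filling k

  encodes-injective : ∀ {D D′ F} → Encodes D F → Encodes D′ F → D ≐ D′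
  encodes-injective (k , copy , refl) (k′ , copy′ , eq) x =
    transport copy copy′ k≗k′ , transport copy′ copy (λ s → sym (k≗k′ s))
    where
    k≗k′ : ∀ {r j} → InShape mu (r , j) → k r j ≡ k′ r j
    k≗k′ {r} {j} s = entry-injectiveˡ r j (tabulateFilling-injective mu _ _ eq r j s)
    transport : ∀ {A B a b} → ShiftedCopy la mu A a → ShiftedCopy la mu B b →
                (∀ {r j} → InShape mu (r , j) → a r j ≡ b r j) → x ∈ A → x ∈ B
    transport {B = B} copyA copyB a≗b x∈A with r , j , s , refl ← D⊆image copyA x x∈A =
      subst (_∈ B) (cong (λ K → (K + r , K + j)) (sym (a≗b s))) (image⊆D copyB r j s)

  excited⇒encoded : ∀ {D} → Excited la mu D → ∃[ F ] F ∈ OOTs × Encodes D F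
  excited⇒encoded E with k , copy ← excited⇒shiftedCopy mu-partition mu⊆la E =
    filling k , filling∈OOTs copy , k , copy , refl

theorem5p1 : (la mu : List ℕ) → IsPartition la → IsPartition mu → mu ⊆ₚ la →
    Connected la mu →
    (Es : List (List Cell)) → AllPairs (λ A B → ¬ (A ≐ B)) Es → All (Excited la mu) Es →
    length Es ≤ OOT la mu
theorem5p1 la mu la-partition mu-partition mu⊆la _ Es distinct excited =
  length-≤-by-injectiveRel _≐_ Encodes encodes-injective distinct (All.map excited⇒encoded excited)
  where open Encoding la-partition mu-partition mu⊆la
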